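{- Let $d$ be a positive integer and for each positive integer $s$ let $N_d(s)$ denote the number of $(s,s+1)$-core partitions with $d$-distinct parts. Then $N_d(s)=s$ for $1\le s\le d+1$, and for $s\ge d+2$, $$N_d(s)=N_d(s-1)+N_d(s-(d+1)).$$
   Context: A partition $\lambda=(\lambda_1,\ldots,\lambda_l)$ is a finite nonincreasing sequence of positive integers (the empty partition included); it has $d$-distinct parts if $\lambda_i-\lambda_{i+1}\ge d$ for all $1\le i\le l-1$. For the box in row $i$, column $j$ of the Young diagram of $\lambda$, the hook length is the number of boxes directly to its right, plus the number directly below it, plus one. $\lambda$ is an $(s_1,\ldots,s_t)$-core partition if no box has hook length equal to any of $s_1,\ldots,s_t$. -}

module Defs where

open import Data.Nat using (ℕ; zero; suc; _+_; _∸_; _≤_; _<_; _<?_)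
open import Data.List using (List; []; _∷_; length; filter; drop)
open import Data.List.Relation.Unary.All using (All)
open import Data.List.Relation.Unary.Linked using (Linked)
open import Data.List.Relation.Unary.Unique.Propositional using (Unique)
open import Data.List.Membership.Propositional using (_∈_)
open import Data.Product using (Σ; _×_)
open import Relation.Binary.PropositionalEquality using (_≡_; _≢_)
open import Function.Bundles using (_⇔_)

record IsPartition (λ′ : List ℕ) : Set where
  field
    nonincreasing : Linked (λ a b → b ≤ a) λ′
    positive      : All (λ a → 1 ≤ a) λ′

DDistinct : ℕ → List ℕ → Set
DDistinct d λ′ = Linked (λ a b → b + d ≤ a) λ′

-- the i-th part (0-indexed), 0 if out of range
part : List ℕ → ℕ → ℕ
part []      _       = 0
part (x ∷ _) zero    = x
part (_ ∷ l) (suc i) = part l i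

-- hook length of the box in row i, column j (both 0-indexed, i.e. row i+1,
-- column j+1 of the Young diagram): boxes to the right + boxes below + 1.
armLength : List ℕ → ℕ → ℕ → ℕ
armLength λ′ i j = part λ′ i ∸ suc j

legLength : List ℕ → ℕ → ℕ → ℕ
legLength λ′ i j = length (filter (λ a → j <? a) (drop (suc i) λ′))

hookLength : List ℕ → ℕ → ℕ → ℕ
hookLength λ′ i j = armLength λ′ i j + legLength λ′ i j + 1

IsBox : List ℕ → ℕ → ℕ → Set
IsBox λ′ i j = (i < length λ′) × (j < part λ′ i)

IsCore2 : ℕ → ℕ → List ℕ → Set
IsCore2 s t λ′ = ∀ i j → IsBox λ′ i j → (hookLength λ′ i j ≢ s) × (hookLength λ′ i j ≢ t)

CoreDDistinct : ℕ → ℕ → List ℕ → Set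
CoreDDistinct d s λ′ = IsPartition λ′ × DDistinct d λ′ × IsCore2 s (suc s) λ′

-- "the number of objects satisfying P is n": there is a duplicate-free list
-- whose members are exactly the objects satisfying P, of length n.
HasCount : (List ℕ → Set) → ℕ → Set
HasCount P n = Σ (List (List ℕ)) λ L → Unique L × (∀ x → (x ∈ L) ⇔ P x) × (length L ≡ n)

module Submission where

-- Write span λ = λ₁ + ℓ(λ) (with span [] = 0), so that the largest hook of a
-- nonempty partition λ is span λ - 1, attained at the corner box (1,1).
--
-- Every hook of λ is smaller than span λ.  Conversely, if
-- the parts of λ are distinct, the hook lengths along the first row decrease by at
-- most 2 from one box to the next and end with 1; so when span λ > s a discrete
-- intermediate value argument finds a first-row hook equal to s or s + 1.  Hence a
-- partition with distinct parts is an (s,s+1)-core iff span λ ≤ s.  Since d ≥ 1,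
-- d-distinct partitions have distinct parts, and N_d(s) counts the d-distinct
-- partitions of span at most s.
--
-- The d-distinct partitions of span exactly k + 2 correspond
-- bijectively to the d-distinct partitions μ of span at most k + 1 - d, via
-- prepending the part k + 1 - ℓ(μ).  Listing the partitions of span ≤ s by this
-- recursion gives N(k + 2) = N(k + 1) + N(k + 1 - d) and N(0) = 1, from which both
-- the initial values and the recurrence of theorem2 follow.

open import Defs
open import Data.Nat using (ℕ; zero; suc; _+_; _∸_; _≤_; _<_; _>_; _≥_; _<?_; _≤?_; z≤n; s≤s; s≤s⁻¹)
open import Data.Nat.Properties
open import Data.Product using (Σ; ∃-syntax; _×_; _,_)
open import Data.Sum using (_⊎_; inj₁; inj₂; [_,_]′)
open import Data.Empty using (⊥-elim)
open import Data.List using (List; []; _∷_; length; filter; drop; map; _++_)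
open import Data.List.Properties using (length-filter; length-drop; filter-accept; filter-reject; filter-all; filter-none; length-++; length-map; ∷-injectiveʳ)
open import Data.List.Relation.Unary.All as All using (All; []; _∷_)
open import Data.List.Relation.Unary.Linked as Linked using (Linked; []; [-]; _∷_)
open import Data.List.Relation.Unary.Linked.Properties using (Linked⇒All)
open import Data.List.Relation.Unary.Unique.Propositional using (Unique)
open import Data.List.Relation.Unary.AllPairs using ([]; _∷_)
import Data.List.Relation.Unary.Unique.Propositional.Properties as Unique
open import Data.List.Membership.Propositional using (_∈_)
open import Data.List.Membership.Propositional.Properties using (∈-++⁻; ∈-++⁺ˡ; ∈-++⁺ʳ; ∈-map⁺; ∈-map⁻)
open import Data.List.Relation.Unary.Any using (here)
open import Relation.Nullary using (¬_; yes; no; contradiction)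
open import Relation.Binary.Definitions using (Transitive)
open import Relation.Binary.PropositionalEquality using (_≡_; refl; sym; trans; cong; cong₂; subst; module ≡-Reasoning)
open import Function.Bundles using (_⇔_; mk⇔; Equivalence)
open import Function.Construct.Composition using (_⇔-∘_)


head-relates-all : ∀ {R : ℕ → ℕ → Set} → Transitive R →
                   ∀ {a μ} → Linked R (a ∷ μ) → All (R a) μ
head-relates-all tr [-]       = []
head-relates-all tr (r ∷ rs) = Linked⇒All tr r rs

part-≤ : ∀ {a} μ → All (_≤ a) μ → ∀ i → part μ i ≤ a
part-≤ []      _          i       = z≤n
part-≤ (b ∷ ν) (b≤a ∷ _)  zero    = b≤a
part-≤ (b ∷ ν) (_ ∷ ν≤a)  (suc i) = part-≤ ν ν≤a i

part-≤-head : ∀ {a μ} → Linked _≥_ (a ∷ μ) → ∀ i → part (a ∷ μ) i ≤ a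
part-≤-head nonincr zero    = ≤-refl
part-≤-head nonincr (suc i) = part-≤ _ (head-relates-all (λ p q → ≤-trans q p) nonincr) i

+-swapʳ : ∀ x y z → x + y + z ≡ x + z + y
+-swapʳ x y z = trans (+-assoc x y z) (trans (cong (x +_) (+-comm y z)) (sym (+-assoc x z y)))

squeezed : ∀ {s x} → s ≤ x → x ≤ suc s → x ≡ s ⊎ x ≡ suc s
squeezed s≤x x≤1+s with m≤n⇒m<n∨m≡n x≤1+s
... | inj₁ x<1+s = inj₁ (≤-antisym (s≤s⁻¹ x<1+s) s≤x)
... | inj₂ x≡1+s = inj₂ x≡1+s

steps-of-two-hit : (h : ℕ → ℕ) (s : ℕ) → (∀ j → h j ≤ 2 + h (suc j)) →
                   ∀ m → s ≤ h 0 → h m ≤ suc s → ∃[ j ] j ≤ m × s ≤ h j × h j ≤ suc s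
steps-of-two-hit h s drop≤2 zero    start end = 0 , z≤n , start , end
steps-of-two-hit h s drop≤2 (suc m) start end with s ≤? h (suc m)
... | yes s≤hm = suc m , ≤-refl , s≤hm , end
... | no  s≰hm with steps-of-two-hit h s drop≤2 m start (≤-trans (drop≤2 m) (s≤s (≰⇒> s≰hm)))
...   | j , j≤m , lower , upper = j , m≤n⇒m≤1+n j≤m , lower , upper


-- span λ = λ₁ + ℓ(λ); the largest hook of λ is span λ - 1.
span : List ℕ → ℕ
span []      = 0
span (a ∷ μ) = suc (a + length μ)

span-∷ : ∀ b ν → span (b ∷ ν) ≡ b + length (b ∷ ν)
span-∷ b ν = sym (+-suc b (length ν))

Strict : List ℕ → Set
Strict = Linked _>_

ddistinct⇒strict : ∀ {d} → 1 ≤ d → ∀ {μ} → DDistinct d μ → Strict μ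
ddistinct⇒strict d≥1 = Linked.map (λ {b} {c} c+d≤b → <-≤-trans (m<m+n c d≥1) c+d≤b)

hook<span : ∀ {λ′} → Linked _≥_ λ′ → ∀ {i j} → IsBox λ′ i j → hookLength λ′ i j < span λ′
hook<span {a ∷ μ} nonincr {i} {j} (_ , j<part) = s≤s (begin
    arm + leg + 1   ≡⟨ +-swapʳ arm leg 1 ⟩
    arm + 1 + leg   ≤⟨ +-mono-≤ arm+1≤a leg≤ℓ ⟩
    a + length μ    ∎)
  where
  open ≤-Reasoning
  arm = armLength (a ∷ μ) i j
  leg = legLength (a ∷ μ) i j
  arm+1≤a : arm + 1 ≤ a
  arm+1≤a = ≤-trans (+-monoʳ-≤ arm (s≤s z≤n))
              (≤-trans (≤-reflexive (m∸n+n≡m j<part)) (part-≤-head nonincr i))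
  leg≤ℓ : leg ≤ length μ
  leg≤ℓ = ≤-trans (length-filter (j <?_) (drop i μ))
            (≤-trans (≤-reflexive (length-drop i μ)) (m∸n≤m (length μ) i))

smallSpan⇒core : ∀ {s λ′} → Linked _≥_ λ′ → span λ′ ≤ s → IsCore2 s (suc s) λ′
smallSpan⇒core {s} {λ′} nonincr span≤s i j box =
  (λ h≡s → <-irrefl h≡s h<s) , (λ h≡1+s → <-irrefl h≡1+s (m<n⇒m<1+n h<s))
  where
  h<s : hookLength λ′ i j < s
  h<s = <-≤-trans (hook<span nonincr box) span≤s

-- The number of parts of μ exceeding j: the leg of box (1, j+1) in a ∷ μ.
partsAbove : ℕ → List ℕ → ℕ
partsAbove j μ = length (filter (j <?_) μ)

partsAbove-accept : ∀ {j b} ν → j < b → partsAbove j (b ∷ ν) ≡ suc (partsAbove j ν)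
partsAbove-accept {j} _ j<b = cong length (filter-accept (j <?_) j<b)

partsAbove-reject : ∀ {j b} ν → ¬ j < b → partsAbove j (b ∷ ν) ≡ partsAbove j ν
partsAbove-reject {j} _ j≮b = cong length (filter-reject (j <?_) j≮b)

partsAbove-none : ∀ {j ν} → All (_≤ j) ν → partsAbove j ν ≡ 0
partsAbove-none {j} ν≤j = cong length (filter-none (j <?_) (All.map ≤⇒≯ ν≤j))

strict-tail-below : ∀ {j b ν} → Strict (b ∷ ν) → b ≤ suc j → All (_≤ j) ν
strict-tail-below distinct b≤1+j =
  All.map (λ c<b → s≤s⁻¹ (<-≤-trans c<b b≤1+j)) (head-relates-all (λ p q → <-trans q p) distinct)

-- In a strictly decreasing list at most one part equals j + 1, so raising the
-- threshold from j to j + 1 loses at most one part.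
partsAbove-step : ∀ j {μ} → Strict μ → partsAbove j μ ≤ suc (partsAbove (suc j) μ)
partsAbove-step j {[]}    _      = z≤n
partsAbove-step j {b ∷ ν} distinct with j <? b | suc j <? b
... | no j≮b | yes 1+j<b = contradiction (<-trans (n<1+n j) 1+j<b) j≮b
... | no j≮b | no 1+j≮b
  rewrite partsAbove-reject ν j≮b | partsAbove-reject ν 1+j≮b = partsAbove-step j (Linked.tail distinct)
... | yes j<b | yes 1+j<b
  rewrite partsAbove-accept ν j<b | partsAbove-accept ν 1+j<b = s≤s (partsAbove-step j (Linked.tail distinct))
... | yes j<b | no 1+j≮b
  -- here b = j + 1, so every later part is at most j
  rewrite partsAbove-accept ν j<b | partsAbove-none (strict-tail-below distinct (≮⇒≥ 1+j≮b)) = s≤s z≤n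

firstRow-step : ∀ {a μ} → Strict (a ∷ μ) → ∀ j →
                hookLength (a ∷ μ) 0 j ≤ 2 + hookLength (a ∷ μ) 0 (suc j)
firstRow-step {a} {μ} distinct j = begin
    (a ∸ suc j) + partsAbove j μ + 1
      ≤⟨ +-monoˡ-≤ 1 (+-mono-≤ (arm-step a j) (partsAbove-step j (Linked.tail distinct))) ⟩
    suc (a ∸ suc (suc j)) + suc (partsAbove (suc j) μ) + 1
      ≡⟨ cong (λ t → suc t + 1) (+-suc (a ∸ suc (suc j)) (partsAbove (suc j) μ)) ⟩
    2 + ((a ∸ suc (suc j)) + partsAbove (suc j) μ + 1) ∎
  where
  open ≤-Reasoning
  arm-step : ∀ m j → m ∸ suc j ≤ suc (m ∸ suc (suc j))
  arm-step zero    j       = z≤n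
  arm-step (suc m) zero    = m≤n+m∸n m 1
  arm-step (suc m) (suc j) = arm-step m j

firstRow-start : ∀ {m μ} → All (1 ≤_) μ → hookLength (suc m ∷ μ) 0 0 ≡ m + length μ + 1
firstRow-start {m} all-positive = cong (λ t → m + t + 1) (cong length (filter-all (0 <?_) all-positive))

firstRow-end : ∀ {m μ} → Strict (suc m ∷ μ) → hookLength (suc m ∷ μ) 0 m ≡ 1
firstRow-end {m} distinct = cong₂ (λ arm leg → arm + leg + 1) (n∸n≡0 m) (partsAbove-none (strict-tail-below distinct ≤-refl))

largeSpan⇒firstRowHook : ∀ {s m μ} → IsPartition (suc m ∷ μ) → Strict (suc m ∷ μ) →
                         s < span (suc m ∷ μ) →
                         ∃[ j ] j ≤ m × (hookLength (suc m ∷ μ) 0 j ≡ s ⊎ hookLength (suc m ∷ μ) 0 j ≡ suc s)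
largeSpan⇒firstRowHook {s} {m} {μ} p distinct s<span =
  let j , j≤m , lower , upper = steps-of-two-hit hook s (firstRow-step distinct) m start end
  in  j , j≤m , squeezed lower upper
  where
  hook : ℕ → ℕ
  hook = hookLength (suc m ∷ μ) 0
  start : s ≤ hook 0
  start = ≤-trans (s≤s⁻¹ s<span)
            (≤-reflexive (trans (+-comm 1 (m + length μ)) (sym (firstRow-start (All.tail (IsPartition.positive p))))))
  end : hook m ≤ suc s
  end = ≤-trans (≤-reflexive (firstRow-end distinct)) (s≤s z≤n)

strictCore⇒smallSpan : ∀ {s λ′} → IsPartition λ′ → Strict λ′ → IsCore2 s (suc s) λ′ → span λ′ ≤ s
strictCore⇒smallSpan {λ′ = []}       _ _ _ = z≤n
strictCore⇒smallSpan {λ′ = zero ∷ μ} p _ _ with IsPartition.positive p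
... | () ∷ _
strictCore⇒smallSpan {s} {suc m ∷ μ} p distinct core with suc (suc m + length μ) ≤? s
... | yes span≤s = span≤s
... | no  span≰s with largeSpan⇒firstRowHook p distinct (≰⇒> span≰s)
...   | j , j≤m , hit with core 0 j (s≤s z≤n , s≤s j≤m)
...     | hook≢s , hook≢1+s = ⊥-elim ([ hook≢s , hook≢1+s ]′ hit)

core⇔smallSpan : ∀ {d s λ′} → 1 ≤ d → IsPartition λ′ → DDistinct d λ′ →
                 IsCore2 s (suc s) λ′ ⇔ span λ′ ≤ s
core⇔smallSpan d≥1 p dd = mk⇔ (strictCore⇒smallSpan p (ddistinct⇒strict d≥1 dd))
                              (smallSpan⇒core (IsPartition.nonincreasing p))

module Enumeration (d : ℕ) where

  SpanAtMost : ℕ → List ℕ → Set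
  SpanAtMost s λ′ = IsPartition λ′ × DDistinct d λ′ × span λ′ ≤ s

  SpanExactly : ℕ → List ℕ → Set
  SpanExactly s λ′ = IsPartition λ′ × DDistinct d λ′ × span λ′ ≡ s

  -- Prepend the part making the span equal to k + 1.
  extend : ℕ → List ℕ → List ℕ
  extend k μ = (k ∸ length μ) ∷ μ

  extend-exact : ∀ k μ → SpanAtMost (suc k ∸ d) μ → SpanExactly (suc (suc k)) (extend (suc k) μ)
  extend-exact k [] _ =
    record { nonincreasing = [-] ; positive = s≤s z≤n ∷ [] } , [-] , cong (λ t → suc (suc t)) (+-identityʳ k)
  extend-exact k (b ∷ ν) (p , dd , span≤) =
    record { nonincreasing = ≤-trans (m≤m+n b d) b+d≤head ∷ IsPartition.nonincreasing p
           ; positive      = ≤-trans (All.head (IsPartition.positive p)) (≤-trans (m≤m+n b d) b+d≤head) ∷ IsPartition.positive p }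
    , b+d≤head ∷ dd , cong suc (m∸n+n≡m ℓ≤1+k)
    where
    ℓ : ℕ
    ℓ = length (b ∷ ν)
    total : b + d + ℓ ≤ suc k
    total = begin
      b + d + ℓ        ≡⟨ +-swapʳ b d ℓ ⟩
      b + ℓ + d        ≡⟨ cong (_+ d) (sym (span-∷ b ν)) ⟩
      span (b ∷ ν) + d ≤⟨ m≤o∸n⇒m+n≤o (span (b ∷ ν)) d≤1+k span≤ ⟩
      suc k ∎
      where
      open ≤-Reasoning
      -- the span of a nonempty list is positive, so suc k ∸ d > 0
      d≤1+k : d ≤ suc k
      d≤1+k = <⇒≤ (m∸n≢0⇒n<m (λ 1+k∸d≡0 → n≮0 (subst (span (b ∷ ν) ≤_) 1+k∸d≡0 span≤)))
    b+d≤head : b + d ≤ suc k ∸ ℓ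
    b+d≤head = m+n≤o⇒m≤o∸n (b + d) total
    ℓ≤1+k : ℓ ≤ suc k
    ℓ≤1+k = m+n≤o⇒n≤o (b + d) total

  tail-atMost : ∀ k a μ → SpanExactly (suc (suc k)) (a ∷ μ) → SpanAtMost (suc k ∸ d) μ
  tail-atMost k a []      _ = record { nonincreasing = [] ; positive = [] } , [] , z≤n
  tail-atMost k a (b ∷ ν) (p , (b+d≤a ∷ dd) , span≡) =
    record { nonincreasing = Linked.tail (IsPartition.nonincreasing p) ; positive = All.tail (IsPartition.positive p) }
    , dd , m+n≤o⇒m≤o∸n (span (b ∷ ν)) total
    where
    open ≤-Reasoning
    ℓ : ℕ
    ℓ = length (b ∷ ν)
    total : span (b ∷ ν) + d ≤ suc k
    total = begin
      span (b ∷ ν) + d ≡⟨ cong (_+ d) (span-∷ b ν) ⟩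
      b + ℓ + d        ≡⟨ +-swapʳ b ℓ d ⟩
      b + d + ℓ        ≤⟨ +-monoˡ-≤ ℓ b+d≤a ⟩
      a + ℓ            ≡⟨ suc-injective span≡ ⟩
      suc k            ∎

  extend-tail : ∀ k a μ → span (a ∷ μ) ≡ suc (suc k) → a ∷ μ ≡ extend (suc k) μ
  extend-tail k a μ span≡ =
    cong (_∷ μ) (trans (sym (m+n∸n≡m a (length μ))) (cong (_∸ length μ) (suc-injective span≡)))

  atMost-split : ∀ {s x} → SpanAtMost (suc s) x → SpanAtMost s x ⊎ SpanExactly (suc s) x
  atMost-split {s} {x} (p , dd , span≤) with span x ≤? s
  ... | yes span≤s = inj₁ (p , dd , span≤s)
  ... | no  span≰s = inj₂ (p , dd , ≤-antisym span≤ (≰⇒> span≰s))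

  -- Enumerations with fuel: for s < f, atMostList f s lists the d-distinct partitions
  -- of span at most s and exactList f s those of span exactly s + 1.
  atMostList : ℕ → ℕ → List (List ℕ)
  exactList  : ℕ → ℕ → List (List ℕ)
  atMostList zero    _       = []
  atMostList (suc f) zero    = [] ∷ []
  atMostList (suc f) (suc s) = atMostList f s ++ exactList f s
  exactList f zero    = []
  exactList f (suc k) = map (extend (suc k)) (atMostList f (suc k ∸ d))

  fuel-∸ : ∀ {k f} → suc k < f → suc k ∸ d < f
  fuel-∸ {k} = ≤-<-trans (m∸n≤m (suc k) d)

  atMost-sound   : ∀ f s → s < f → ∀ {x} → x ∈ atMostList f s → SpanAtMost s x
  exact-sound    : ∀ f s → s < f → ∀ {x} → x ∈ exactList f s → SpanExactly (suc s) x
  atMost-sound (suc f) zero    _         (here refl) = record { nonincreasing = [] ; positive = [] } , [] , z≤n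
  atMost-sound (suc f) (suc s) (s≤s s<f) x∈ with ∈-++⁻ (atMostList f s) x∈
  ... | inj₁ x∈atMost with atMost-sound f s s<f x∈atMost
  ...   | p , dd , span≤s = p , dd , m≤n⇒m≤1+n span≤s
  atMost-sound (suc f) (suc s) (s≤s s<f) x∈ | inj₂ x∈exact with exact-sound f s s<f x∈exact
  ...   | p , dd , span≡ = p , dd , ≤-reflexive span≡
  exact-sound f (suc k) k<f x∈ with ∈-map⁻ (extend (suc k)) x∈
  ... | μ , μ∈ , refl = extend-exact k μ (atMost-sound f (suc k ∸ d) (fuel-∸ k<f) μ∈)

  atMost-complete : ∀ f s → s < f → ∀ {x} → SpanAtMost s x → x ∈ atMostList f s
  exact-complete  : ∀ f s → s < f → ∀ {x} → SpanExactly (suc s) x → x ∈ exactList f s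
  atMost-complete (suc f) zero    _         {[]}    _            = here refl
  atMost-complete (suc f) (suc s) (s≤s s<f) x-atMost with atMost-split x-atMost
  ... | inj₁ x-atMost′ = ∈-++⁺ˡ (atMost-complete f s s<f x-atMost′)
  ... | inj₂ x-exact   = ∈-++⁺ʳ (atMostList f s) (exact-complete f s s<f x-exact)
  exact-complete f zero    _   {zero ∷ μ}  (p , _ , _) with IsPartition.positive p
  ... | () ∷ _
  exact-complete f zero    _   {suc a ∷ μ} (_ , _ , ())
  exact-complete f (suc k) k<f {a ∷ μ} x-exact@(_ , _ , span≡) =
    subst (_∈ exactList f (suc k)) (sym (extend-tail k a μ span≡))
      (∈-map⁺ (extend (suc k)) (atMost-complete f (suc k ∸ d) (fuel-∸ k<f) (tail-atMost k a μ x-exact)))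

  -- The enumerations contain no duplicates: the two halves of atMostList are
  -- disjoint by span, and extend is injective.
  atMost-unique : ∀ f s → s < f → Unique (atMostList f s)
  exact-unique  : ∀ f s → s < f → Unique (exactList f s)
  atMost-unique (suc f) zero    _         = [] ∷ []
  atMost-unique (suc f) (suc s) (s≤s s<f) = Unique.++⁺ (atMost-unique f s s<f) (exact-unique f s s<f) disjoint
    where
    disjoint : ∀ {x} → ¬ (x ∈ atMostList f s × x ∈ exactList f s)
    disjoint (x∈atMost , x∈exact) with atMost-sound f s s<f x∈atMost | exact-sound f s s<f x∈exact
    ... | _ , _ , span≤s | _ , _ , span≡ = <-irrefl refl (≤-<-trans span≤s (≤-reflexive (sym span≡)))
  exact-unique f zero    _   = []
  exact-unique f (suc k) k<f = Unique.map⁺ ∷-injectiveʳ (atMost-unique f (suc k ∸ d) (fuel-∸ k<f))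

  atMost-fuel : ∀ f g s → s < f → s < g → atMostList f s ≡ atMostList g s
  exact-fuel  : ∀ f g s → s < f → s < g → exactList f s ≡ exactList g s
  atMost-fuel (suc f) (suc g) zero    _         _         = refl
  atMost-fuel (suc f) (suc g) (suc s) (s≤s s<f) (s≤s s<g) = cong₂ _++_ (atMost-fuel f g s s<f s<g) (exact-fuel f g s s<f s<g)
  exact-fuel f g zero    _   _   = refl
  exact-fuel f g (suc k) k<f k<g = cong (map (extend (suc k))) (atMost-fuel f g (suc k ∸ d) (fuel-∸ k<f) (fuel-∸ k<g))

  enumeration : ℕ → List (List ℕ)
  enumeration s = atMostList (suc s) s

  N : ℕ → ℕ
  N s = length (enumeration s)

  enumeration-∈ : ∀ s x → x ∈ enumeration s ⇔ SpanAtMost s x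
  enumeration-∈ s x = mk⇔ (atMost-sound (suc s) s ≤-refl) (atMost-complete (suc s) s ≤-refl)

  enumeration-unique : ∀ s → Unique (enumeration s)
  enumeration-unique s = atMost-unique (suc s) s ≤-refl

  N-step : ∀ k → N (suc (suc k)) ≡ N (suc k) + N (suc k ∸ d)
  N-step k = begin
    length (enumeration (suc k) ++ exactList (suc (suc k)) (suc k))
      ≡⟨ length-++ (enumeration (suc k)) ⟩
    N (suc k) + length (map (extend (suc k)) (atMostList (suc (suc k)) (suc k ∸ d)))
      ≡⟨ cong (N (suc k) +_) (length-map (extend (suc k)) (atMostList (suc (suc k)) (suc k ∸ d))) ⟩
    N (suc k) + length (atMostList (suc (suc k)) (suc k ∸ d))
      ≡⟨ cong (λ l → N (suc k) + length l) (atMost-fuel _ _ (suc k ∸ d) (fuel-∸ ≤-refl) ≤-refl) ⟩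
    N (suc k) + N (suc k ∸ d) ∎
    where open ≡-Reasoning

  -- Initial values: N(k + 1) = k + 1 for k ≤ d, since then N(k + 1 - d) = N(0) = 1.
  N-initial : ∀ k → k ≤ d → N (suc k) ≡ suc k
  N-initial zero    _       = refl
  N-initial (suc k) 1+k≤d = begin
    N (suc (suc k))          ≡⟨ N-step k ⟩
    N (suc k) + N (suc k ∸ d) ≡⟨ cong₂ _+_ (N-initial k (<⇒≤ 1+k≤d)) (cong N (m≤n⇒m∸n≡0 1+k≤d)) ⟩
    suc k + 1                ≡⟨ +-comm (suc k) 1 ⟩
    suc (suc k)              ∎
    where open ≡-Reasoning

theorem2 : (d : ℕ) → 1 ≤ d →
    Σ (ℕ → ℕ) λ N →
      (∀ s → 1 ≤ s → HasCount (CoreDDistinct d s) (N s))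
      × (∀ s → 1 ≤ s → s ≤ d + 1 → N s ≡ s)
      × (∀ s → d + 2 ≤ s → N s ≡ N (s ∸ 1) + N (s ∸ (d + 1)))
theorem2 d d≥1 = N , counts , initial , recurrence
  where
  open Enumeration d
  atMost⇔core : ∀ s x → SpanAtMost s x ⇔ CoreDDistinct d s x
  atMost⇔core s x = mk⇔ (λ (p , dd , span≤s) → p , dd , Equivalence.from (core⇔smallSpan d≥1 p dd) span≤s)
                        (λ (p , dd , core) → p , dd , Equivalence.to (core⇔smallSpan d≥1 p dd) core)
  counts : ∀ s → 1 ≤ s → HasCount (CoreDDistinct d s) (N s)
  counts s _ = enumeration s , enumeration-unique s , (λ x → atMost⇔core s x ⇔-∘ enumeration-∈ s x) , refl
  initial : ∀ s → 1 ≤ s → s ≤ d + 1 → N s ≡ s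
  initial (suc k) _ 1+k≤d+1 = N-initial k (s≤s⁻¹ (subst (suc k ≤_) (+-comm d 1) 1+k≤d+1))
  recurrence : ∀ s → d + 2 ≤ s → N s ≡ N (s ∸ 1) + N (s ∸ (d + 1))
  recurrence s d+2≤s with m+n≤o⇒n≤o d d+2≤s
  ... | s≤s (s≤s _) rewrite +-comm d 1 = N-step _
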